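{- Let $\beta>0$ and let $G$ be a connected $(n,\beta)$-graph. Then $t(G)\ge\frac{1-\beta}{\beta}$.
   Context: All graphs are finite, simple and nonempty. The toughness $t(G)$ of a connected graph $G$ is the minimum of $\frac{|S|}{c(G-S)}$ over all proper subsets $S\subset V(G)$ with $G-S$ disconnected, where $c(G-S)$ is the number of components of $G-S$; the toughness of a complete graph is $\infty$. For vertex sets $X,Y$, $e(X,Y)$ is the number of edges with one end in $X$ and the other in $Y$ (edges with both ends in $X\cap Y$ counted twice). A graph on $n$ vertices is an $(n,\beta)$-graph if $\frac{|X||Y|}{(n-|X|)(n-|Y|)}\le\beta^2$ for every pair of (not necessarily disjoint) proper subsets $X,Y$ of $V(G)$ with $e(X,Y)=0$. By convention $K_n$ is an $(n,\beta)$-graph for every $\beta>0$.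
   Formalization: The parameter β ranges over the positive rationals. -}

module Defs where

open import Data.Nat as ℕ using (ℕ; zero; suc)
import Data.Nat.Properties as ℕ
open import Data.Fin using (Fin)
open import Data.Fin.Subset using (Subset; _∈_; _∉_; ∣_∣; ⊤)
open import Data.Bool using (Bool; true; false; if_then_else_)
open import Data.List using (List; map; allFin)
open import Data.Nat.ListAction using (sum)
open import Data.Product using (Σ; _×_; _,_; ∃)
open import Data.Sum using (_⊎_)
open import Relation.Binary.PropositionalEquality using (_≡_; _≢_)
open import Relation.Nullary using (¬_)
open import Data.Rational as ℚ using (ℚ; 0ℚ; 1ℚ; _≤_; _*_; _-_; _÷_; _>_; >-nonZero)
open import Function using (_⇔_)

record Graph (n : ℕ) : Set where
  field
    adj      : Fin n → Fin n → Bool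
    symmetric  : ∀ u v → adj u v ≡ adj v u
    irreflexive : ∀ v → adj v v ≡ false
open Graph public

[_] : Bool → ℕ
[ true ]  = 1
[ false ] = 0

open import Data.Vec using (lookup)
mem : ∀ {n} → Subset n → Fin n → Bool
mem X v = lookup X v

_∧_ : Bool → Bool → Bool
true  ∧ b = b
false ∧ _ = false

-- e(X,Y): number of ordered pairs (u,v), u ∈ X, v ∈ Y, with uv an edge
-- (edges with both ends in X ∩ Y are thus counted twice).
e : ∀ {n} → Graph n → Subset n → Subset n → ℕ
e {n} G X Y =
  sum (map (λ u → sum (map (λ v → [ mem X u ∧ (mem Y v ∧ adj G u v) ]) (allFin n))) (allFin n))

data Reach {n} (G : Graph n) (S : Subset n) : Fin n → Fin n → Set where
  here : ∀ {v} → v ∉ S → Reach G S v v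
  step : ∀ {u w v} → u ∉ S → adj G u w ≡ true → Reach G S w v → Reach G S u v

Connected : ∀ {n} → Graph n → Set
Connected {n} G = ∀ (u v : Fin n) → Reach G (Data.Fin.Subset.⊥) u v

IsComplete : ∀ {n} → Graph n → Set
IsComplete {n} G = ∀ (u v : Fin n) → u ≢ v → adj G u v ≡ true

-- G - S has exactly k components: there is a surjection from the vertices
-- of G - S onto Fin k identifying exactly the mutually reachable vertices.
HasComponents : ∀ {n} → Graph n → Subset n → ℕ → Set
HasComponents {n} G S k =
  Σ (Fin n → Fin k) λ comp →
    (∀ u v → u ∉ S → v ∉ S → (comp u ≡ comp v ⇔ Reach G S u v)) ×
    (∀ (i : Fin k) → ∃ λ v → v ∉ S × comp v ≡ i)

toℚ : ℕ → ℚ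
toℚ m = ℤ.+ m ℚ./ 1
  where import Data.Integer as ℤ

ratio : (a b : ℕ) → ℕ.NonZero b → ℚ
ratio a b nz = ℤ.+ a ℚ./ b
  where import Data.Integer as ℤ
        instance _ = nz

-- t(G) ≥ x : toughness is the minimum of |S| / c(G-S) over proper S with
-- G - S disconnected (∞ if there is no such S, e.g. for complete graphs).
-- So t(G) ≥ x iff every such S satisfies |S| / c(G-S) ≥ x.
ToughnessAtLeast : ∀ {n} → Graph n → ℚ → Set
ToughnessAtLeast {n} G x =
  ∀ (S : Subset n) (k : ℕ) → S ≢ ⊤ → HasComponents G S k →
    (2≤k : 2 ℕ.≤ k) →
    x ≤ ratio ∣ S ∣ k (ℕ.>-nonZero (ℕ.≤-trans (ℕ.s≤s ℕ.z≤n) 2≤k))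

-- (n,β)-graph (with β² written as β * β; denominators cleared, which is
-- harmless as n - |X|, n - |Y| > 0 for proper X, Y), with the convention
-- that K_n is an (n,β)-graph.
IsNBetaGraph : ∀ {n} → Graph n → ℚ → Set
IsNBetaGraph {n} G β =
  IsComplete G ⊎
  (∀ (X Y : Subset n) → X ≢ ⊤ → Y ≢ ⊤ → e G X Y ≡ 0 →
     toℚ (∣ X ∣ ℕ.* ∣ Y ∣) ≤ (β * β) * toℚ ((n ℕ.∸ ∣ X ∣) ℕ.* (n ℕ.∸ ∣ Y ∣)))

bound : (β : ℚ) → β > 0ℚ → ℚ
bound β β>0 = (1ℚ - β) ÷ β
  where instance _ = >-nonZero β>0

{-# OPTIONS --safe #-}
-- Let S cut G into k ≥ 2 components and put s = |S|. Each component is placed wholly into X,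
-- wholly into Y, or gives one representative vertex to both; then e(X, Y) = 0, because an edge
-- between X and Y would join two vertices of one component, hence be a loop at a representative.
-- If moreover
--   k² (n − |X|) (n − |Y|) ≤ (s + k)² |X| |Y|,                                  (∗)
-- the (n, β) condition gives k ≤ β (s + k), that is s / k ≥ (1 − β) / β.
-- For (∗) it suffices that both surpluses (s + k)|X| − k(n − |Y|) and (s + k)|Y| − k(n − |X|) are
-- nonnegative, and each is a sum of gains of the single components. One scan through the
-- components, keeping lower bounds for the two surpluses in multiples of s, reaches this except
-- when exactly one component has three or more vertices and all others are singletons; there (∗)
-- is checked directly. Connectivity gives s ≥ 1, so X and Y are proper, and a complete graph has
-- no cut at all.
module Submission where

open import Defs

module RationalBounds where

  open import Data.Nat as ℕ using (ℕ; suc; NonZero)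
  import Data.Nat.Properties as ℕP
  open import Data.Integer as ℤ using (+_)
  import Data.Integer.Properties as ℤP
  open import Data.Nat.Coprimality using (1-coprimeTo; sym)
  open import Data.Rational as ℚ using (ℚ; mkℚ; 0ℚ; 1ℚ; _≤_; _<_; _*_; _+_; _-_; _>_; 1/_; -_)
  open import Data.Rational.Properties
  open import Data.Rational.Solver using (module +-*-Solver)
  open import Relation.Binary.PropositionalEquality using (_≡_; refl; cong; cong₂; subst₂; trans) renaming (sym to ≡-sym)
  open import Relation.Nullary using (yes; no)
  open import Relation.Nullary.Negation using (contradiction)
  open +-*-Solver

  -- toℚ with its normal form already computed, so that ring operations on ι-values reduce.
  ι : ℕ → ℚ
  ι m = mkℚ (+ m) 0 (sym (1-coprimeTo m))

  toℚ≡ι : ∀ m → toℚ m ≡ ι m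
  toℚ≡ι m = normalize-coprime (sym (1-coprimeTo m))

  ι-* : ∀ a b → ι (a ℕ.* b) ≡ ι a * ι b
  ι-* a b = trans (≡-sym (toℚ≡ι (a ℕ.* b))) (/-cong (ℤP.pos-* a b) refl)

  ι-+ : ∀ a b → ι (a ℕ.+ b) ≡ ι a + ι b
  ι-+ a b = trans (≡-sym (toℚ≡ι (a ℕ.+ b)))
    (/-cong (trans (ℤP.pos-+ a b) (≡-sym (cong₂ ℤ._+_ (ℤP.*-identityʳ (+ a)) (ℤP.*-identityʳ (+ b))))) refl)

  ι-mono-≤ : ∀ {a b} → a ℕ.≤ b → ι a ≤ ι b
  ι-mono-≤ {a} {b} a≤b =
    ℚ.*≤* (subst₂ ℤ._≤_ (≡-sym (ℤP.*-identityʳ (+ a))) (≡-sym (ℤP.*-identityʳ (+ b))) (ℤ.+≤+ a≤b))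

  instance
    ι-nonNeg : ∀ {m} → ℚ.NonNegative (ι m)
    ι-nonNeg {m} = ℚ.nonNegative (ι-mono-≤ {0} {m} ℕ.z≤n)

  ratio≡ι*1/ι : ∀ s k (nz : NonZero (suc k)) → ratio s (suc k) nz ≡ ι s * 1/ ι (suc k)
  ratio≡ι*1/ι s k nz = /-cong (≡-sym (ℤP.*-identityʳ (+ s))) (≡-sym (ℕP.*-identityˡ (suc k)))

  ≤-of-squares : ∀ x y .{{_ : ℚ.NonNegative y}} → x * x ≤ y * y → x ≤ y
  ≤-of-squares x y xx≤yy with x ≤? y
  ... | yes x≤y = x≤y
  ... | no x≰y = contradiction (<-≤-trans yy<xx xx≤yy) (<-irrefl refl)
    where
      y<x : y < x
      y<x = ≰⇒> x≰y
      instance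
        x-pos : ℚ.Positive x
        x-pos = ℚ.positive (≤-<-trans (nonNegative⁻¹ y) y<x)
      yy<xx : y * y < x * x
      yy<xx = ≤-<-trans (*-monoˡ-≤-nonNeg y (<⇒≤ y<x)) (*-monoˡ-<-pos x y<x)

  module _ (β : ℚ) (β>0 : β > 0ℚ) where

    instance
      β-pos : ℚ.Positive β
      β-pos = ℚ.positive β>0
      β-nonNeg : ℚ.NonNegative β
      β-nonNeg = pos⇒nonNeg β
      β-nonZero : ℚ.NonZero β
      β-nonZero = ℚ.>-nonZero β>0

    k≤β[s+k] : ∀ s k {N} M → 1 ℕ.≤ N → toℚ M ≤ β * β * toℚ N →
      k ℕ.* k ℕ.* N ℕ.≤ (s ℕ.+ k) ℕ.* (s ℕ.+ k) ℕ.* M → ι k ≤ β * ι (s ℕ.+ k)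
    k≤β[s+k] s k {suc N} M _ M≤β²N k²N≤[s+k]²M =
      ≤-of-squares κ (β * τ) {{nonNeg*nonNeg⇒nonNeg β τ}} (*-cancelʳ-≤-pos ν (begin
        κ * κ * ν                          ≡⟨ ≡-sym (ι-*³ k k (suc N)) ⟩
        ι (k ℕ.* k ℕ.* suc N)              ≤⟨ ι-mono-≤ k²N≤[s+k]²M ⟩
        ι ((s ℕ.+ k) ℕ.* (s ℕ.+ k) ℕ.* M)  ≡⟨ ι-*³ (s ℕ.+ k) (s ℕ.+ k) M ⟩
        τ * τ * ι M                        ≤⟨ *-monoˡ-≤-nonNeg (τ * τ) {{nonNeg*nonNeg⇒nonNeg τ τ}} M≤β²ν ⟩
        τ * τ * (β * β * ν)                ≡⟨ solve 3 (λ t b n → t :* t :* (b :* b :* n) := b :* t :* (b :* t) :* n)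
                                                      refl τ β ν ⟩
        β * τ * (β * τ) * ν                ∎))
      where
        open ≤-Reasoning
        κ τ ν : ℚ
        κ = ι k
        τ = ι (s ℕ.+ k)
        ν = ι (suc N)
        ι-*³ : ∀ a b c → ι (a ℕ.* b ℕ.* c) ≡ ι a * ι b * ι c
        ι-*³ a b c = trans (ι-* (a ℕ.* b) c) (cong (_* ι c) (ι-* a b))
        M≤β²ν : ι M ≤ β * β * ν
        M≤β²ν = subst₂ _≤_ (toℚ≡ι M) (cong (β * β *_) (toℚ≡ι (suc N))) M≤β²N

    bound≤ratio : ∀ s k (nz : NonZero (suc k)) → ι (suc k) ≤ β * ι (s ℕ.+ suc k) →
                  bound β β>0 ≤ ratio s (suc k) nz
    bound≤ratio s k nz κ≤β[σ+κ] rewrite ratio≡ι*1/ι s k nz | ι-+ s (suc k) =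
      *-cancelʳ-≤-pos (β * κ) {{pos*pos⇒pos β κ}} (begin
        (1ℚ - β) * 1/ β * (β * κ)  ≡⟨ solve 3 (λ b b⁻¹ k → (con 1ℚ :- b) :* b⁻¹ :* (b :* k)
                                                          := (con 1ℚ :- b) :* k :* (b⁻¹ :* b)) refl β (1/ β) κ ⟩
        (1ℚ - β) * κ * (1/ β * β)  ≡⟨ cong ((1ℚ - β) * κ *_) (*-inverseˡ β) ⟩
        (1ℚ - β) * κ * 1ℚ          ≡⟨ solve 2 (λ b k → (con 1ℚ :- b) :* k :* con 1ℚ := k :+ :- (b :* k)) refl β κ ⟩
        κ - β * κ                  ≤⟨ +-monoˡ-≤ (- (β * κ)) κ≤β[σ+κ] ⟩
        β * (σ + κ) - β * κ        ≡⟨ solve 3 (λ b s k → b :* (s :+ k) :+ :- (b :* k) := s :* b :* con 1ℚ) refl β σ κ ⟩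
        σ * β * 1ℚ                 ≡⟨ cong (σ * β *_) (≡-sym (*-inverseˡ κ)) ⟩
        σ * β * (1/ κ * κ)         ≡⟨ solve 4 (λ s b k⁻¹ k → s :* b :* (k⁻¹ :* k) := s :* k⁻¹ :* (b :* k))
                                            refl σ β (1/ κ) κ ⟩
        σ * 1/ κ * (β * κ)         ∎)
      where
        open ≤-Reasoning
        σ κ : ℚ
        σ = ι s
        κ = ι (suc k)

    product-bound⇒bound≤ratio : ∀ s k {N} M (nz : NonZero (suc k)) → 1 ℕ.≤ N → toℚ M ≤ β * β * toℚ N →
      suc k ℕ.* suc k ℕ.* N ℕ.≤ (s ℕ.+ suc k) ℕ.* (s ℕ.+ suc k) ℕ.* M →
      bound β β>0 ≤ ratio s (suc k) nz
    product-bound⇒bound≤ratio s k M nz 1≤N M≤β²N k²N≤[s+k]²M =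
      bound≤ratio s k nz (k≤β[s+k] s (suc k) M 1≤N M≤β²N k²N≤[s+k]²M)

open import Data.Nat using (ℕ; zero; suc; _+_; _*_; _∸_; _≤_; z≤n; s≤s; NonZero)
open import Data.Nat.Properties hiding (_≟_; 0≢1+n)
import Data.Nat.Tactic.RingSolver as ℕ-Ring
open import Data.Bool using (Bool; true; false; not)
open import Data.Fin using (Fin; zero; suc)
open import Data.Fin.Properties using (_≟_; 0≢1+n)
open import Data.Fin.Subset using (Subset; _∉_; ∣_∣; ⊤)
open import Data.Fin.Subset.Properties using (∣⊤∣≡n; nonempty?; Empty-unique; x∈p⇒∣p-x∣<∣p∣)
open import Data.Vec as Vec using (lookup; tabulate)
open import Data.Vec.Properties using (lookup∘tabulate; []=⇒lookup; lookup⇒[]=)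
open import Data.Vec.Functional using (_∷_; tail)
open import Data.List using (List; map; allFin)
import Data.Nat.ListAction as List
open import Data.Product using (_×_; _,_; proj₁; proj₂; ∃)
open import Data.Sum as Sum using (inj₁; inj₂; _⊎_)
open import Data.Empty using (⊥; ⊥-elim)
open import Function using (_∘_; Equivalence)
open import Relation.Binary.PropositionalEquality hiding ([_])
open import Relation.Nullary using (¬_; does; yes; no; contradiction)
open import Relation.Nullary.Decidable using (dec-true)
open import Algebra.Properties.Semiring.Sum +-*-semiring using (sum; sum-cong-≗; ∑-comm; ∑-distrib-+; *-distribˡ-sum)
open import Algebra.Properties.CommutativeSemigroup +-commutativeSemigroup using (x∙yz≈y∙xz)
open import Data.Rational using (ℚ; 0ℚ; _>_)
open RationalBounds using (product-bound⇒bound≤ratio)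

∑-const : ∀ n m → sum {n} (λ _ → m) ≡ n * m
∑-const zero    m = refl
∑-const (suc n) m = cong (_+_ m) (∑-const n m)

n≡∑1 : ∀ n → n ≡ sum {n} (λ _ → 1)
n≡∑1 n = sym (trans (∑-const n 1) (*-identityʳ n))

term≤sum : ∀ {m} (f : Fin m → ℕ) j → f j ≤ sum f
term≤sum f zero    = m≤m+n (f zero) _
term≤sum f (suc j) = ≤-trans (term≤sum (f ∘ suc) j) (m≤n+m _ (f zero))

∑-δ : ∀ {m} (f : Fin m → ℕ) j → sum (λ i → [ does (i ≟ j) ] * f i) ≡ f j
∑-δ {suc m} f zero    = trans (cong (_+_ (f zero + 0)) (trans (∑-const m 0) (*-zeroʳ m)))
                              (trans (+-identityʳ _) (+-identityʳ _))
∑-δ {suc m} f (suc j) = ∑-δ (f ∘ suc) j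

∑-fibres : ∀ {m k} (comp : Fin m → Fin k) (F : Fin k → Fin m → ℕ) →
           sum (λ v → F (comp v) v) ≡ sum (λ i → sum (λ v → [ does (i ≟ comp v) ] * F i v))
∑-fibres comp F = trans (sum-cong-≗ (λ v → sym (∑-δ (λ i → F i v) (comp v))))
                        (∑-comm (λ v i → [ does (i ≟ comp v) ] * F i v))

∣p∣≡∑ : ∀ {m} (p : Subset m) → ∣ p ∣ ≡ sum (λ v → [ lookup p v ])
∣p∣≡∑ Vec.[]          = refl
∣p∣≡∑ (true Vec.∷ p)  = cong suc (∣p∣≡∑ p)
∣p∣≡∑ (false Vec.∷ p) = ∣p∣≡∑ p

n∸∣p∣≥1⇒p≢⊤ : ∀ {n} (p : Subset n) → 1 ≤ n ∸ ∣ p ∣ → p ≢ ⊤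
n∸∣p∣≥1⇒p≢⊤ {n} p 1≤n∸∣p∣ refl with subst (1 ≤_) (trans (cong (n ∸_) (∣⊤∣≡n n)) (n∸n≡0 n)) 1≤n∸∣p∣
... | ()

sum-map-zero : ∀ {A : Set} (f : A → ℕ) → (∀ x → f x ≡ 0) → (xs : List A) → List.sum (map f xs) ≡ 0
sum-map-zero f f≡0 List.[]        = refl
sum-map-zero f f≡0 (x List.∷ xs) = cong₂ _+_ (f≡0 x) (sum-map-zero f f≡0 xs)

[a∧b]≡[a]*[b] : ∀ a b → [ a ∧ b ] ≡ [ a ] * [ b ]
[a∧b]≡[a]*[b] true  true  = refl
[a∧b]≡[a]*[b] true  false = refl
[a∧b]≡[a]*[b] false _     = refl

∧-elim : ∀ {a b} → a ∧ b ≡ true → a ≡ true × b ≡ true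
∧-elim {true} {true} _ = refl , refl

b≢true⇒[b]≡0 : ∀ {b} → b ≢ true → [ b ] ≡ 0
b≢true⇒[b]≡0 {true}  b≢true = ⊥-elim (b≢true refl)
b≢true⇒[b]≡0 {false} _      = refl

does-≟⇒≡ : ∀ {m} {a b : Fin m} → does (a ≟ b) ≡ true → a ≡ b
does-≟⇒≡ {a = a} {b} _ with a ≟ b
... | yes a≡b = a≡b

-- How a component of G − S enters the pair (X, Y): wholly into X, wholly into Y, or through one
-- representative vertex lying in both.
data Role : Set where
  wholeX wholeY shared : Role

mirror : Role → Role
mirror wholeX = wholeY
mirror wholeY = wholeX
mirror shared = shared

xPart : Role → ℕ → ℕ
xPart wholeX c = c
xPart wholeY c = 0
xPart shared c = 1

yPart : Role → ℕ → ℕ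
yPart l = xPart (mirror l)

xPart≤ : ∀ l {c} → 1 ≤ c → xPart l c ≤ c
xPart≤ wholeX _   = ≤-refl
xPart≤ wholeY _   = z≤n
xPart≤ shared 1≤c = 1≤c

allShared : ∀ {j} → Fin j → Role
allShared _ = shared

module _ {j : ℕ} (L : Fin j → Role) (c : Fin j → ℕ) where

  sizeX sizeY restX restY : ℕ
  sizeX = sum (λ i → xPart (L i) (c i))
  sizeY = sum (λ i → yPart (L i) (c i))
  restX = sum (λ i → c i ∸ xPart (L i) (c i))
  restY = sum (λ i → c i ∸ yPart (L i) (c i))

data SizeClass (c : ℕ) : Set where
  single : c ≡ 1 → SizeClass c
  double : c ≡ 2 → SizeClass c
  large  : 3 ≤ c → SizeClass c

classify : ∀ {c} → 1 ≤ c → SizeClass c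
classify {1}                 _ = single refl
classify {2}                 _ = double refl
classify {suc (suc (suc c))} _ = large (s≤s (s≤s (s≤s z≤n)))

record OneLarge {j} (L : Fin j → Role) (c : Fin j → ℕ) : Set where
  field
    largeSize       : ℕ
    3≤largeSize     : 3 ≤ largeSize
    j≡1+sizeY       : j ≡ suc (sizeY L c)
    sizeX≡          : sizeX L c ≡ largeSize + sizeY L c
    restX≡0         : restX L c ≡ 0
    restY≡largeSize : restY L c ≡ largeSize

open OneLarge

product-of-bounds : ∀ K T {p q a b} → K * p ≤ T * b → K * q ≤ T * a → K * K * (p * q) ≤ T * T * (a * b)
product-of-bounds K T {p} {q} {a} {b} Kp≤Tb Kq≤Ta = begin
    K * K * (p * q)     ≡⟨ interchange K K p q ⟩
    (K * p) * (K * q)   ≤⟨ *-mono-≤ Kp≤Tb Kq≤Ta ⟩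
    (T * b) * (T * a)   ≡⟨ sym (interchange T T b a) ⟩
    T * T * (b * a)     ≡⟨ cong (_*_ (T * T)) (*-comm b a) ⟩
    T * T * (a * b)     ∎
  where
    open ≤-Reasoning
    interchange : ∀ x y u v → x * y * (u * v) ≡ (x * u) * (y * v)
    interchange = ℕ-Ring.solve-∀

-- With C = 3 + c and B = 1 + b the difference of the two sides has only nonnegative coefficients.
oneLarge-inequality : ∀ s {K C B} → 3 ≤ C → 2 ≤ K → K ≡ suc B →
                      K * K * ((s + 0) * (s + C)) ≤ (s + K) * (s + K) * ((C + B) * B)
oneLarge-inequality s {C = suc (suc (suc c))} {B = suc b} (s≤s (s≤s (s≤s _))) (s≤s (s≤s _)) refl
  rewrite +-identityʳ s = ≤-trans (m≤m+n _ _) (≤-reflexive (sym (expand s c b)))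
  where
    expand : ∀ s c b → (s + (2 + b)) * (s + (2 + b)) * ((3 + c + (1 + b)) * (1 + b)) ≡
      (2 + b) * (2 + b) * (s * (s + (3 + c))) +
      (16 + 36 * b + 28 * b * b + 9 * b * b * b + b * b * b * b + 4 * c + 8 * c * b + 5 * c * b * b
       + c * b * b * b + 4 * s + 16 * s * b + 11 * s * b * b + 2 * s * b * b * b + 2 * s * c * b
       + s * c * b * b + s * s * b + s * s * c + s * s * c * b)
    expand = ℕ-Ring.solve-∀

module Surplus (s K : ℕ) where

  open import Data.Integer as ℤ using (ℤ; +_; 0ℤ; -1ℤ; +≤+)
  import Data.Integer.Properties as ℤP
  import Data.Integer.Tactic.RingSolver as ℤ-Ring
  open import Algebra.Properties.Monoid.Sum ℤP.+-0-monoid using () renaming (sum to ∑ᶻ)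

  -- Over the K components, gain ∣Cᵢ ∩ X∣ ∣Cᵢ ∖ Y∣ sums to (s + K)|X| − K(n − |Y|),
  -- since n − |Y| = s + Σᵢ ∣Cᵢ ∖ Y∣.
  gain : ℕ → ℕ → ℤ
  gain a q = + ((s + K) * a) ℤ.- + (s + K * q)

  gainX gainY : Role → ℕ → ℤ
  gainX l c = gain (xPart l c) (c ∸ yPart l c)
  gainY l c = gain (yPart l c) (c ∸ xPart l c)

  surplusX surplusY : ∀ {j} → (Fin j → Role) → (Fin j → ℕ) → ℤ
  surplusX L c = ∑ᶻ (λ i → gainX (L i) (c i))
  surplusY L c = ∑ᶻ (λ i → gainY (L i) (c i))

  record AtLeast (ℓ x : ℤ) : Set where
    constructor atLeast
    field ℓs≤x : ℓ ℤ.* + s ℤ.≤ x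

  record GainLevels (ℓx ℓy : ℤ) (l : Role) (c : ℕ) : Set where
    constructor _,_
    field
      x-gain : AtLeast ℓx (gainX l c)
      y-gain : AtLeast ℓy (gainY l c)

  record Levels (ℓx ℓy : ℤ) {j} (L : Fin j → Role) (c : Fin j → ℕ) : Set where
    constructor _,_
    field
      x-surplus : AtLeast ℓx (surplusX L c)
      y-surplus : AtLeast ℓy (surplusY L c)

  AtLeast-+ : ∀ {ℓ₁ ℓ₂ x y} → AtLeast ℓ₁ x → AtLeast ℓ₂ y → AtLeast (ℓ₁ ℤ.+ ℓ₂) (x ℤ.+ y)
  AtLeast-+ {ℓ₁} {ℓ₂} (atLeast p) (atLeast q) =
    atLeast (ℤP.≤-trans (ℤP.≤-reflexive (ℤP.*-distribʳ-+ (+ s) ℓ₁ ℓ₂)) (ℤP.+-mono-≤ p q))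

  AtLeast⇒0≤ : ∀ {ℓ x} → AtLeast ℓ x → 0ℤ ℤ.≤ ℓ → 0ℤ ℤ.≤ x
  AtLeast⇒0≤ (atLeast ℓs≤x) 0≤ℓ = ℤP.≤-trans (ℤP.*-monoʳ-≤-nonNeg (+ s) 0≤ℓ) ℓs≤x

  Levels-∷ : ∀ {gx gy ℓx ℓy j l} {L : Fin j → Role} {c : Fin (suc j) → ℕ} →
             GainLevels gx gy l (c zero) → Levels ℓx ℓy L (tail c) →
             Levels (gx ℤ.+ ℓx) (gy ℤ.+ ℓy) (l ∷ L) c
  Levels-∷ (gx , gy) (ℓx , ℓy) = AtLeast-+ gx ℓx , AtLeast-+ gy ℓy

  gain-nonNeg : ∀ {a q} → s + K * q ≤ (s + K) * a → AtLeast 0ℤ (gain a q)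
  gain-nonNeg {a} {q} demand≤supply =
    atLeast (subst (ℤ._≤ gain a q) (sym (ℤP.*-zeroˡ (+ s))) (ℤP.i≤j⇒0≤j-i (+≤+ demand≤supply)))

  gain-whole : ∀ c → gain (suc c) (suc c) ≡ + (s * c)
  gain-whole c = begin
      + ((s + K) * suc c) ℤ.- + (s + K * suc c)
        ≡⟨ cong (λ x → + x ℤ.- + (s + K * suc c)) (split s K c) ⟩
      (+ (s * c) ℤ.+ + (s + K * suc c)) ℤ.- + (s + K * suc c)
        ≡⟨ [a+b]-b≡a (+ (s * c)) (+ (s + K * suc c)) ⟩
      + (s * c) ∎
    where
      open ≡-Reasoning
      split : ∀ s K c → (s + K) * suc c ≡ s * c + (s + K * suc c)
      split = ℕ-Ring.solve-∀
      [a+b]-b≡a : ∀ a b → (a ℤ.+ b) ℤ.- b ≡ a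
      [a+b]-b≡a = ℤ-Ring.solve-∀

  gain-empty : ∀ c → gain 0 (c ∸ c) ≡ ℤ.- + s
  gain-empty c rewrite *-zeroʳ (s + K) | n∸n≡0 c | *-zeroʳ K | +-identityʳ s = ℤP.+-identityˡ (ℤ.- + s)

  shared-gain : ∀ {c} → c ≤ 2 → GainLevels 0ℤ 0ℤ shared c
  shared-gain {c} c≤2 = both , both
    where
      both : AtLeast 0ℤ (gain 1 (c ∸ 1))
      both = gain-nonNeg (begin
        s + K * (c ∸ 1) ≤⟨ +-monoʳ-≤ s (*-monoʳ-≤ K (∸-monoˡ-≤ 1 c≤2)) ⟩
        s + K * 1       ≡⟨ cong (_+_ s) (*-identityʳ K) ⟩
        s + K           ≡⟨ sym (*-identityʳ (s + K)) ⟩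
        (s + K) * 1     ∎)
        where open ≤-Reasoning

  wholeX-gain : ∀ {m c} → suc m ≤ c → GainLevels (+ m) -1ℤ wholeX c
  wholeX-gain {m} {suc c} (s≤s m≤c) =
    atLeast (subst (ℤ._≤ _) (ℤP.pos-* m s) (subst (λ x → + (m * s) ℤ.≤ x) (sym (gain-whole c))
      (+≤+ (subst (_≤ s * c) (*-comm s m) (*-monoʳ-≤ s m≤c))))) ,
    atLeast (ℤP.≤-reflexive (trans (ℤP.-1*i≡-i (+ s)) (sym (gain-empty (suc c)))))

  wholeY-gain : ∀ {m c} → suc m ≤ c → GainLevels -1ℤ (+ m) wholeY c
  wholeY-gain m<c = let (x , y) = wholeX-gain m<c in y , x

  shared-levels : ∀ {j} {c : Fin j → ℕ} → (∀ i → c i ≤ 2) → Levels 0ℤ 0ℤ allShared c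
  shared-levels {zero}      _   = atLeast ℤP.≤-refl , atLeast ℤP.≤-refl
  shared-levels {suc j} {c} c≤2 =
    let (x , y) = Levels-∷ {c = c} (shared-gain (c≤2 zero)) (shared-levels (c≤2 ∘ suc)) in x , y

  ∑ᶻ-⊖ : ∀ {n} (u d : Fin n → ℕ) → ∑ᶻ (λ i → + u i ℤ.- + d i) ≡ + sum u ℤ.- + sum d
  ∑ᶻ-⊖ {zero}  u d = refl
  ∑ᶻ-⊖ {suc n} u d = begin
      (+ u zero ℤ.- + d zero) ℤ.+ ∑ᶻ (λ i → + u (suc i) ℤ.- + d (suc i))
        ≡⟨ cong (λ x → (+ u zero ℤ.- + d zero) ℤ.+ x) (∑ᶻ-⊖ (tail u) (tail d)) ⟩
      (+ u zero ℤ.- + d zero) ℤ.+ (+ sum (tail u) ℤ.- + sum (tail d))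
        ≡⟨ interchange (+ u zero) (+ d zero) (+ sum (tail u)) (+ sum (tail d)) ⟩
      (+ u zero ℤ.+ + sum (tail u)) ℤ.- (+ d zero ℤ.+ + sum (tail d)) ∎
    where
      open ≡-Reasoning
      interchange : ∀ a b c d → (a ℤ.- b) ℤ.+ (c ℤ.- d) ≡ (a ℤ.+ c) ℤ.- (b ℤ.+ d)
      interchange = ℤ-Ring.solve-∀

  demand≤supply : (a q : Fin K → ℕ) → 0ℤ ℤ.≤ ∑ᶻ (λ i → gain (a i) (q i)) → K * (s + sum q) ≤ (s + K) * sum a
  demand≤supply a q 0≤∑gain = begin
      K * (s + sum q)                          ≡⟨ *-distribˡ-+ K s (sum q) ⟩
      K * s + K * sum q                        ≡⟨ cong₂ _+_ (sym (∑-const K s)) (*-distribˡ-sum K q) ⟩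
      sum {K} (λ _ → s) + sum (λ i → K * q i)  ≡⟨ sym (∑-distrib-+ {K} (λ _ → s) (λ i → K * q i)) ⟩
      sum (λ i → s + K * q i)                  ≤⟨ ℤP.drop‿+≤+ (ℤP.0≤i-j⇒j≤i 0≤supply-demand) ⟩
      sum (λ i → (s + K) * a i)                ≡⟨ sym (*-distribˡ-sum (s + K) a) ⟩
      (s + K) * sum a                          ∎
    where
      open ≤-Reasoning
      0≤supply-demand : 0ℤ ℤ.≤ + sum (λ i → (s + K) * a i) ℤ.- + sum (λ i → s + K * q i)
      0≤supply-demand = subst (0ℤ ℤ.≤_) (∑ᶻ-⊖ (λ i → (s + K) * a i) (λ i → s + K * q i)) 0≤∑gain

  ProductBound : (Fin K → Role) → (Fin K → ℕ) → Set
  ProductBound L c = K * K * ((s + restX L c) * (s + restY L c)) ≤ (s + K) * (s + K) * (sizeX L c * sizeY L c)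

  levels⇒product-bound : ∀ {ℓx ℓy L c} → 0ℤ ℤ.≤ ℓx → 0ℤ ℤ.≤ ℓy → Levels ℓx ℓy L c → ProductBound L c
  levels⇒product-bound {L = L} {c} 0≤ℓx 0≤ℓy (x , y) = product-of-bounds K (s + K)
    (demand≤supply (λ i → yPart (L i) (c i)) (λ i → c i ∸ xPart (L i) (c i)) (AtLeast⇒0≤ y 0≤ℓy))
    (demand≤supply (λ i → xPart (L i) (c i)) (λ i → c i ∸ yPart (L i) (c i)) (AtLeast⇒0≤ x 0≤ℓx))

  oneLarge⇒product-bound : ∀ {L c} → 2 ≤ K → OneLarge L c → ProductBound L c
  oneLarge⇒product-bound 2≤K q rewrite restX≡0 q | restY≡largeSize q | sizeX≡ q =
    oneLarge-inequality s (3≤largeSize q) 2≤K (j≡1+sizeY q)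

module Scan (s K : ℕ) where

  open import Data.Integer using (+_; 0ℤ; -1ℤ; +≤+)
  open import Data.Integer.Properties using () renaming (≤-refl to ℤ-≤-refl)
  open Surplus s K

  -- In `small` every component may be shared, and L
  -- keeps a Y-surplus of s in reserve for putting a later large component into X. In `oneLarge` the
  -- Y-surplus may be negative for every labelling; there the product bound is checked directly.
  data Progress {j} (c : Fin j → ℕ) : Set where
    singletons : (∀ i → c i ≡ 1) → Progress c
    small      : (∀ i → c i ≤ 2) → (L : Fin j → Role) → Levels -1ℤ (+ 1) L c → Progress c
    oneLarge   : (L : Fin j → Role) → OneLarge L c → Levels (+ 2) -1ℤ L c → Progress c
    balanced   : (L : Fin j → Role) → Levels (+ 1) 0ℤ L c ⊎ Levels 0ℤ (+ 1) L c → Progress c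

  private
    extend : ∀ {j} (P : ℕ → Set) {c : Fin (suc j) → ℕ} → P (c zero) → (∀ i → P (c (suc i))) → ∀ i → P (c i)
    extend P p ps zero    = p
    extend P p ps (suc i) = ps i

    ≡1⇒≤2 : ∀ {c} → c ≡ 1 → c ≤ 2
    ≡1⇒≤2 refl = s≤s z≤n

    ≡2⇒2≤ : ∀ {c} → c ≡ 2 → 2 ≤ c
    ≡2⇒2≤ refl = ≤-refl

    ∑∸1≡0 : ∀ {j} {c : Fin j → ℕ} → (∀ i → c i ≡ 1) → sum (λ i → c i ∸ 1) ≡ 0
    ∑∸1≡0 {j} c≡1 = trans (sum-cong-≗ (λ i → cong (_∸ 1) (c≡1 i))) (trans (∑-const j 0) (*-zeroʳ j))

  start-oneLarge : ∀ {j} (c : Fin (suc j) → ℕ) → 3 ≤ c zero → (∀ i → c (suc i) ≡ 1) →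
                   OneLarge (wholeX ∷ allShared) c
  start-oneLarge {j} c 3≤c₀ c≡1 = record
    { largeSize       = c zero
    ; 3≤largeSize     = 3≤c₀
    ; j≡1+sizeY       = cong suc (n≡∑1 j)
    ; sizeX≡          = refl
    ; restX≡0         = cong₂ _+_ (n∸n≡0 (c zero)) (∑∸1≡0 c≡1)
    ; restY≡largeSize = trans (cong (_+_ (c zero)) (∑∸1≡0 c≡1)) (+-identityʳ (c zero))
    }

  extend-oneLarge : ∀ {j} {L : Fin j → Role} (c : Fin (suc j) → ℕ) → c zero ≡ 1 →
                    OneLarge L (tail c) → OneLarge (shared ∷ L) c
  extend-oneLarge c c₀≡1 q = record
    { largeSize       = largeSize q
    ; 3≤largeSize     = 3≤largeSize q
    ; j≡1+sizeY       = cong suc (j≡1+sizeY q)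
    ; sizeX≡          = trans (cong suc (sizeX≡ q)) (sym (+-suc (largeSize q) _))
    ; restX≡0         = cong₂ _+_ (cong (_∸ 1) c₀≡1) (restX≡0 q)
    ; restY≡largeSize = cong₂ _+_ (cong (_∸ 1) c₀≡1) (restY≡largeSize q)
    }

  add-component : ∀ {j} (c : Fin (suc j) → ℕ) → SizeClass (c zero) → Progress (tail c) → Progress c
  add-component c (single c₀≡1) (singletons c≡1) = singletons (extend (_≡ 1) c₀≡1 c≡1)
  add-component c (double c₀≡2) (singletons c≡1) =
    small (extend (_≤ 2) (≤-reflexive c₀≡2) (≡1⇒≤2 ∘ c≡1)) (wholeY ∷ allShared)
          (Levels-∷ (wholeY-gain (≡2⇒2≤ c₀≡2)) (shared-levels (≡1⇒≤2 ∘ c≡1)))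
  add-component c (large 3≤c₀)  (singletons c≡1) =
    oneLarge (wholeX ∷ allShared) (start-oneLarge c 3≤c₀ c≡1)
             (Levels-∷ (wholeX-gain 3≤c₀) (shared-levels (≡1⇒≤2 ∘ c≡1)))
  add-component c (single c₀≡1) (small c≤2 L lv) =
    small (extend (_≤ 2) (≡1⇒≤2 c₀≡1) c≤2) (shared ∷ L)
          (Levels-∷ (shared-gain (≡1⇒≤2 c₀≡1)) lv)
  add-component c (double c₀≡2) (small c≤2 L lv) =
    small (extend (_≤ 2) (≤-reflexive c₀≡2) c≤2) (shared ∷ L)
          (Levels-∷ (shared-gain (≤-reflexive c₀≡2)) lv)
  add-component c (large 3≤c₀)  (small _ L lv) =
    balanced (wholeX ∷ L) (inj₁ (Levels-∷ (wholeX-gain 3≤c₀) lv))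
  add-component c (single c₀≡1) (oneLarge L q lv) =
    oneLarge (shared ∷ L) (extend-oneLarge c c₀≡1 q) (Levels-∷ (shared-gain (≡1⇒≤2 c₀≡1)) lv)
  add-component c (double c₀≡2) (oneLarge L _ lv) =
    balanced (wholeY ∷ L) (inj₁ (Levels-∷ (wholeY-gain (≡2⇒2≤ c₀≡2)) lv))
  add-component c (large 3≤c₀)  (oneLarge L _ lv) =
    balanced (wholeY ∷ L) (inj₁ (Levels-∷ (wholeY-gain (<⇒≤ 3≤c₀)) lv))
  add-component c (single c₀≡1) (balanced L lv) =
    balanced (shared ∷ L) (Sum.map (Levels-∷ g) (Levels-∷ g) lv)
    where g = shared-gain (≡1⇒≤2 c₀≡1)
  add-component c (double c₀≡2) (balanced L lv) =
    balanced (shared ∷ L) (Sum.map (Levels-∷ g) (Levels-∷ g) lv)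
    where g = shared-gain (≤-reflexive c₀≡2)
  add-component c (large 3≤c₀)  (balanced L (inj₁ lv)) =
    balanced (wholeY ∷ L) (inj₂ (Levels-∷ (wholeY-gain (<⇒≤ 3≤c₀)) lv))
  add-component c (large 3≤c₀)  (balanced L (inj₂ lv)) =
    balanced (wholeX ∷ L) (inj₁ (Levels-∷ (wholeX-gain (<⇒≤ 3≤c₀)) lv))

  progress : ∀ {j} (c : Fin j → ℕ) → (∀ i → 1 ≤ c i) → Progress c
  progress {zero}  c _   = singletons (λ ())
  progress {suc j} c c≥1 = add-component c (classify (c≥1 zero)) (progress (tail c) (c≥1 ∘ suc))

  progress⇒product-bound : 2 ≤ K → ∀ {c} → Progress c → ∃ λ L → ProductBound L c
  progress⇒product-bound _   (singletons c≡1) =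
    allShared , levels⇒product-bound ℤ-≤-refl ℤ-≤-refl (shared-levels (≡1⇒≤2 ∘ c≡1))
  progress⇒product-bound _   (small c≤2 _ _) =
    allShared , levels⇒product-bound ℤ-≤-refl ℤ-≤-refl (shared-levels c≤2)
  progress⇒product-bound 2≤K (oneLarge L q _) = L , oneLarge⇒product-bound 2≤K q
  progress⇒product-bound _   (balanced L (inj₁ lv)) = L , levels⇒product-bound (+≤+ z≤n) ℤ-≤-refl lv
  progress⇒product-bound _   (balanced L (inj₂ lv)) = L , levels⇒product-bound ℤ-≤-refl (+≤+ z≤n) lv

labelling-exists : ∀ s {K} → 2 ≤ K → (c : Fin K → ℕ) → (∀ i → 1 ≤ c i) → ∃ λ L → Surplus.ProductBound s K L c
labelling-exists s 2≤K c c≥1 = progress⇒product-bound 2≤K (progress c c≥1)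
  where open Scan s _

record Witness {n} (G : Graph n) (S : Subset n) (k : ℕ) : Set where
  field
    X Y               : Subset n
    X≢⊤               : X ≢ ⊤
    Y≢⊤               : Y ≢ ⊤
    no-edges          : e G X Y ≡ 0
    1≤[n∸∣X∣]*[n∸∣Y∣] : 1 ≤ (n ∸ ∣ X ∣) * (n ∸ ∣ Y ∣)
    product-bound     : k * k * ((n ∸ ∣ X ∣) * (n ∸ ∣ Y ∣)) ≤ (∣ S ∣ + k) * (∣ S ∣ + k) * (∣ X ∣ * ∣ Y ∣)

module Components {n k} (G : Graph n) (S : Subset n) (components : HasComponents G S k) where

  comp : Fin n → Fin k
  comp = proj₁ components

  same-comp : ∀ {u v} → u ∉ S → v ∉ S → Reach G S u v → comp u ≡ comp v
  same-comp u∉S v∉S = Equivalence.from (proj₁ (proj₂ components) _ _ u∉S v∉S)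

  rep : Fin k → Fin n
  rep i = proj₁ (proj₂ (proj₂ components) i)

  rep∉S : ∀ i → rep i ∉ S
  rep∉S i = proj₁ (proj₂ (proj₂ (proj₂ components) i))

  comp-rep : ∀ i → comp (rep i) ≡ i
  comp-rep i = proj₂ (proj₂ (proj₂ (proj₂ components) i))

  separated : ∀ {i j} → i ≢ j → ¬ Reach G S (rep i) (rep j)
  separated {i} {j} i≢j r = i≢j (trans (sym (comp-rep i)) (trans (same-comp (rep∉S i) (rep∉S j) r) (comp-rep j)))

  rep-distinct : ∀ {i j} → i ≢ j → rep i ≢ rep j
  rep-distinct {i} i≢j rep-i≡rep-j = separated i≢j (subst (Reach G S (rep i)) rep-i≡rep-j (here (rep∉S i)))

  ¬complete : ∀ {i j} → i ≢ j → ¬ IsComplete G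
  ¬complete {i} {j} i≢j complete =
    separated i≢j (step (rep∉S i) (complete (rep i) (rep j) (rep-distinct i≢j)) (here (rep∉S j)))

  connected⇒1≤∣S∣ : Connected G → ∀ {i j} → i ≢ j → 1 ≤ ∣ S ∣
  connected⇒1≤∣S∣ conn {i} {j} i≢j with nonempty? S
  ... | yes (v , v∈S) = ≤-trans (s≤s z≤n) (x∈p⇒∣p-x∣<∣p∣ v∈S)
  ... | no S-empty    =
    ⊥-elim (separated i≢j (subst (λ T → Reach G T (rep i) (rep j)) (sym (Empty-unique S-empty)) (conn _ _)))

  outsideS : Fin n → Bool
  outsideS v = not (lookup S v)

  ∉⇒outsideS : ∀ {v} → v ∉ S → outsideS v ≡ true
  ∉⇒outsideS {v} v∉S with lookup S v in eq
  ... | true  = ⊥-elim (v∉S (lookup⇒[]= v S eq))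
  ... | false = refl

  outsideS⇒∉ : ∀ {v} → outsideS v ≡ true → v ∉ S
  outsideS⇒∉ out v∈S with trans (sym (cong not ([]=⇒lookup v∈S))) out
  ... | ()

  size : Fin k → ℕ
  size i = sum (λ v → [ does (i ≟ comp v) ] * [ outsideS v ])

  rep-counted : ∀ i → [ does (i ≟ comp (rep i)) ] * [ outsideS (rep i) ] ≡ 1
  rep-counted i rewrite comp-rep i | dec-true (i ≟ i) refl | ∉⇒outsideS (rep∉S i) = refl

  size≥1 : ∀ i → 1 ≤ size i
  size≥1 i = subst (_≤ size i) (rep-counted i) (term≤sum (λ v → [ does (i ≟ comp v) ] * [ outsideS v ]) (rep i))

  n≡∣S∣+∑size : n ≡ ∣ S ∣ + sum size
  n≡∣S∣+∑size = begin
      n                                                        ≡⟨ n≡∑1 n ⟩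
      sum {n} (λ _ → 1)                                        ≡⟨ sum-cong-≗ (λ v → in-or-out (lookup S v)) ⟩
      sum (λ v → [ lookup S v ] + [ outsideS v ])
        ≡⟨ ∑-distrib-+ (λ v → [ lookup S v ]) (λ v → [ outsideS v ]) ⟩
      sum (λ v → [ lookup S v ]) + sum (λ v → [ outsideS v ])
        ≡⟨ cong₂ _+_ (sym (∣p∣≡∑ S)) (∑-fibres comp (λ _ v → [ outsideS v ])) ⟩
      ∣ S ∣ + sum size                                         ∎
    where
      open ≡-Reasoning
      in-or-out : ∀ b → 1 ≡ [ b ] + [ not b ]
      in-or-out true  = refl
      in-or-out false = refl

  member : Role → Fin k → Fin n → Bool
  member wholeX _ _ = true
  member wholeY _ _ = false
  member shared i v = does (v ≟ rep i)

  inX : (Fin k → Role) → Fin n → Bool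
  inX L v = outsideS v ∧ member (L (comp v)) (comp v) v

  X Y : (Fin k → Role) → Subset n
  X L = tabulate (inX L)
  Y L = X (mirror ∘ L)

  component-count : ∀ l i → sum (λ v → [ does (i ≟ comp v) ] * [ outsideS v ∧ member l i v ]) ≡ xPart l (size i)
  component-count wholeX i = sum-cong-≗ λ v →
    cong ([ does (i ≟ comp v) ] *_) (trans ([a∧b]≡[a]*[b] (outsideS v) true) (*-identityʳ _))
  component-count wholeY i = trans (sum-cong-≗ λ v →
    trans (cong ([ does (i ≟ comp v) ] *_) (trans ([a∧b]≡[a]*[b] (outsideS v) false) (*-zeroʳ [ outsideS v ])))
          (*-zeroʳ [ does (i ≟ comp v) ]))
    (trans (∑-const n 0) (*-zeroʳ n))
  component-count shared i = begin
      sum (λ v → [ does (i ≟ comp v) ] * [ outsideS v ∧ does (v ≟ rep i) ])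
        ≡⟨ sum-cong-≗ (λ v → trans (cong ([ does (i ≟ comp v) ] *_) ([a∧b]≡[a]*[b] (outsideS v) _))
                                   (rearrange [ does (i ≟ comp v) ] [ outsideS v ] [ does (v ≟ rep i) ])) ⟩
      sum (λ v → [ does (v ≟ rep i) ] * ([ does (i ≟ comp v) ] * [ outsideS v ]))
        ≡⟨ ∑-δ (λ v → [ does (i ≟ comp v) ] * [ outsideS v ]) (rep i) ⟩
      [ does (i ≟ comp (rep i)) ] * [ outsideS (rep i) ]
        ≡⟨ rep-counted i ⟩
      1 ∎
    where
      open ≡-Reasoning
      rearrange : ∀ a b c → a * (b * c) ≡ c * (a * b)
      rearrange = ℕ-Ring.solve-∀

  ∣X∣≡sizeX : ∀ L → ∣ X L ∣ ≡ sizeX L size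
  ∣X∣≡sizeX L = begin
      ∣ X L ∣                         ≡⟨ ∣p∣≡∑ (X L) ⟩
      sum (λ v → [ lookup (X L) v ])  ≡⟨ sum-cong-≗ (λ v → cong [_] (lookup∘tabulate (inX L) v)) ⟩
      sum (λ v → [ inX L v ])         ≡⟨ ∑-fibres comp (λ i v → [ outsideS v ∧ member (L i) i v ]) ⟩
      sum (λ i → sum (λ v → [ does (i ≟ comp v) ] * [ outsideS v ∧ member (L i) i v ]))
                                      ≡⟨ sum-cong-≗ (λ i → component-count (L i) i) ⟩
      sizeX L size                    ∎
    where open ≡-Reasoning

  n∸∣X∣≡∣S∣+restX : ∀ L → n ∸ ∣ X L ∣ ≡ ∣ S ∣ + restX L size
  n∸∣X∣≡∣S∣+restX L = begin
      n ∸ ∣ X L ∣                           ≡⟨ cong₂ _∸_ (trans n≡∣S∣+∑size (cong (∣ S ∣ +_) ∑size≡)) (∣X∣≡sizeX L) ⟩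
      (∣ S ∣ + (sizeX′ + restX′)) ∸ sizeX′ ≡⟨ cong (_∸ sizeX′) (x∙yz≈y∙xz ∣ S ∣ sizeX′ restX′) ⟩
      (sizeX′ + (∣ S ∣ + restX′)) ∸ sizeX′ ≡⟨ m+n∸m≡n sizeX′ _ ⟩
      ∣ S ∣ + restX′                        ∎
    where
      open ≡-Reasoning
      sizeX′ restX′ : ℕ
      sizeX′ = sizeX L size
      restX′ = restX L size
      ∑size≡ : sum size ≡ sizeX′ + restX′
      ∑size≡ = trans (sum-cong-≗ (λ i → sym (m+[n∸m]≡n (xPart≤ (L i) (size≥1 i)))))
                     (∑-distrib-+ (λ i → xPart (L i) (size i)) (λ i → size i ∸ xPart (L i) (size i)))

  1≤n∸∣X∣ : ∀ L → 1 ≤ ∣ S ∣ → 1 ≤ n ∸ ∣ X L ∣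
  1≤n∸∣X∣ L 1≤∣S∣ = subst (1 ≤_) (sym (n∸∣X∣≡∣S∣+restX L)) (≤-trans 1≤∣S∣ (m≤m+n ∣ S ∣ _))

  member-exclusive : ∀ l i {u v} → member l i u ≡ true → member (mirror l) i v ≡ true → u ≡ v
  member-exclusive shared i u≡rep v≡rep = trans (does-≟⇒≡ u≡rep) (sym (does-≟⇒≡ v≡rep))

  no-edge : ∀ L {u v} → inX L u ≡ true → inX (mirror ∘ L) v ≡ true → adj G u v ≡ true → ⊥
  no-edge L {u} {v} u∈X v∈Y uv = contradiction (trans (sym (irreflexive G u)) uu) λ ()
    where
      u∉S : u ∉ S
      u∉S = outsideS⇒∉ (proj₁ (∧-elim u∈X))
      v∉S : v ∉ S
      v∉S = outsideS⇒∉ (proj₁ (∧-elim v∈Y))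
      same : comp u ≡ comp v
      same = same-comp u∉S v∉S (step u∉S uv (here v∉S))
      u≡v : u ≡ v
      u≡v = member-exclusive (L (comp u)) (comp u) (proj₂ (∧-elim u∈X))
              (subst (λ i → member (mirror (L i)) i v ≡ true) (sym same) (proj₂ (∧-elim v∈Y)))
      uu : adj G u u ≡ true
      uu = subst (λ w → adj G u w ≡ true) (sym u≡v) uv

  e[X,Y]≡0 : ∀ L → e G (X L) (Y L) ≡ 0
  e[X,Y]≡0 L = sum-map-zero _ (λ u → sum-map-zero _ (edge-term u) (allFin n)) (allFin n)
    where
      edge-term : ∀ u v → [ mem (X L) u ∧ (mem (Y L) v ∧ adj G u v) ] ≡ 0
      edge-term u v rewrite lookup∘tabulate (inX L) u | lookup∘tabulate (inX (mirror ∘ L)) v =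
        b≢true⇒[b]≡0 λ uvY → let (u∈X , vY) = ∧-elim uvY ; (v∈Y , uv) = ∧-elim vY in no-edge L u∈X v∈Y uv

  witness : 2 ≤ k → 1 ≤ ∣ S ∣ → Witness G S k
  witness 2≤k 1≤∣S∣ with labelling-exists ∣ S ∣ 2≤k size size≥1
  ... | L , bound = record
    { X                 = X L
    ; Y                 = Y L
    ; X≢⊤               = n∸∣p∣≥1⇒p≢⊤ (X L) (1≤n∸∣X∣ L 1≤∣S∣)
    ; Y≢⊤               = n∸∣p∣≥1⇒p≢⊤ (Y L) (1≤n∸∣X∣ (mirror ∘ L) 1≤∣S∣)
    ; no-edges          = e[X,Y]≡0 L
    ; 1≤[n∸∣X∣]*[n∸∣Y∣] = *-mono-≤ (1≤n∸∣X∣ L 1≤∣S∣) (1≤n∸∣X∣ (mirror ∘ L) 1≤∣S∣)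
    ; product-bound     = subst₂ (λ N M → k * k * N ≤ (∣ S ∣ + k) * (∣ S ∣ + k) * M)
                            (sym (cong₂ _*_ (n∸∣X∣≡∣S∣+restX L) (n∸∣X∣≡∣S∣+restX (mirror ∘ L))))
                            (sym (cong₂ _*_ (∣X∣≡sizeX L) (∣X∣≡sizeX (mirror ∘ L))))
                            bound
    }

theorem4p2 : (n : ℕ) → NonZero n → (G : Graph n) (β : ℚ) (β>0 : β > 0ℚ) →
    Connected G → IsNBetaGraph G β → ToughnessAtLeast G (bound β β>0)
theorem4p2 n _ G β β>0 conn (inj₁ complete) S _ _ components (s≤s (s≤s z≤n)) =
  ⊥-elim (Components.¬complete G S components (0≢1+n {i = zero}) complete)
theorem4p2 n _ G β β>0 conn (inj₂ nβ) S (suc (suc k)) _ components 2≤k@(s≤s (s≤s z≤n)) =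
  product-bound⇒bound≤ratio β β>0 ∣ S ∣ (suc k) (∣ X ∣ * ∣ Y ∣) _
    1≤[n∸∣X∣]*[n∸∣Y∣] (nβ X Y X≢⊤ Y≢⊤ no-edges) product-bound
  where
    module C = Components G S components
    open Witness (C.witness 2≤k (C.connected⇒1≤∣S∣ conn (0≢1+n {i = zero})))
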